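{- Let $G=(V,E)$ be a finite graph with $|V|=n$ and let $\overline G$ be its complement. Then $\mathrm{c\text{ - }rk}\,G+\mathrm{c\text{ - }rk}\,\overline G<\sqrt2\,n+1$.
   Context: Graphs are finite, undirected, without loops or multiple edges. The complement $\overline G=(V,\overline E)$ has $\{v,w\}\in\overline E$ iff $v\ne w$ and $\{v,w\}\notin E$. $\mathrm{c\text{ - }rk}\,H$ is the maximum number of independent columns of the $V\times V$ boolean matrix $A^c_H$ (entry $0$ if $\{i,j\}$ is an edge of $H$, else $1$), where vectors over the superboolean semiring $\{0,1,1^\nu\}$ (with $0+x=x$, $1+1=1^\nu$, $1^\nu+x=1^\nu$, $0\cdot x=0$, $1\cdot1=1$, $1\cdot1^\nu=1^\nu\cdot1^\nu=1^\nu$) are dependent if some $\{0,1\}$-combination with not all coefficients zero has all coordinates in $\{0,1^\nu\}$, independent otherwise. -}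

module Defs where

open import Data.Bool using (Bool; true; false; if_then_else_; not)
open import Data.Nat using (ℕ; zero; suc; _*_; _∸_; _<_; _≤_)
open import Data.Fin using (Fin; zero; suc; _≟_)
open import Data.Fin.Subset using (Subset; _⊆_; Nonempty; ∣_∣)
open import Data.Vec using (lookup)
open import Data.Product using (Σ; ∃; _×_)
open import Data.Sum using (_⊎_)
open import Relation.Nullary using (¬_)
open import Relation.Nullary.Decidable using (⌊_⌋)
open import Relation.Binary.PropositionalEquality using (_≡_)

record Graph (n : ℕ) : Set where
  field
    adj       : Fin n → Fin n → Bool
    adj-sym   : ∀ i j → adj i j ≡ adj j i
    adj-irrefl : ∀ i → adj i i ≡ false
open Graph public

complement : ∀ {n} → Graph n → Graph n
complement {n} G = record { adj = cadj ; adj-sym = csym ; adj-irrefl = cirr }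
  where
  cadj : Fin n → Fin n → Bool
  cadj i j = if ⌊ i ≟ j ⌋ then false else not (adj G i j)
  csym : ∀ i j → cadj i j ≡ cadj j i
  csym i j with i ≟ j | j ≟ i
  ... | Relation.Nullary.yes _ | Relation.Nullary.yes _ = _≡_.refl
  ... | Relation.Nullary.yes p | Relation.Nullary.no q = Data.Empty.⊥-elim (q (Relation.Binary.PropositionalEquality.sym p))
    where import Data.Empty
  ... | Relation.Nullary.no p | Relation.Nullary.yes q = Data.Empty.⊥-elim (p (Relation.Binary.PropositionalEquality.sym q))
    where import Data.Empty
  ... | Relation.Nullary.no _ | Relation.Nullary.no _ =
    Relation.Binary.PropositionalEquality.cong not (adj-sym G i j)
  cirr : ∀ i → cadj i i ≡ false
  cirr i with i ≟ i
  ... | Relation.Nullary.yes _ = _≡_.refl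
  ... | Relation.Nullary.no p = Data.Empty.⊥-elim (p _≡_.refl)
    where import Data.Empty

data SB : Set where
  𝟘 𝟙 𝟙ν : SB

_⊕_ : SB → SB → SB
𝟘  ⊕ x = x
𝟙  ⊕ 𝟘 = 𝟙
𝟙  ⊕ 𝟙 = 𝟙ν
𝟙  ⊕ 𝟙ν = 𝟙ν
𝟙ν ⊕ _ = 𝟙ν

_⊗_ : SB → SB → SB
𝟘  ⊗ _ = 𝟘
𝟙  ⊗ x = x
𝟙ν ⊗ 𝟘 = 𝟘
𝟙ν ⊗ _ = 𝟙ν

sumSB : ∀ {n} → (Fin n → SB) → SB
sumSB {zero}  f = 𝟘
sumSB {suc n} f = f zero ⊕ sumSB (λ j → f (suc j))

IsGhost : SB → Set
IsGhost x = x ≡ 𝟘 ⊎ x ≡ 𝟙ν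

fromBool : Bool → SB
fromBool true  = 𝟙
fromBool false = 𝟘

cAdjMatrix : ∀ {n} → Graph n → Fin n → Fin n → SB
cAdjMatrix H i j = if adj H i j then 𝟘 else 𝟙

combo : ∀ {n} → (Fin n → Fin n → SB) → Subset n → Fin n → SB
combo A T i = sumSB (λ j → fromBool (lookup T j) ⊗ A i j)

DependentCols : ∀ {n} → (Fin n → Fin n → SB) → Subset n → Set
DependentCols A S = Σ (Subset _) λ T → T ⊆ S × Nonempty T × (∀ i → IsGhost (combo A T i))

IndependentCols : ∀ {n} → (Fin n → Fin n → SB) → Subset n → Set
IndependentCols A S = ¬ DependentCols A S

IsCRank : ∀ {n} → Graph n → ℕ → Set
IsCRank H r =
  (∃ λ S → IndependentCols (cAdjMatrix H) S × ∣ S ∣ ≡ r) ×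
  (∀ S → IndependentCols (cAdjMatrix H) S → ∣ S ∣ ≤ r)

-- a < √2 · n + 1 for natural a, n, stated without reals:
-- either a = 0, or a ≥ 1 and (a-1)^2 < 2 n^2.
LtSqrt2TimesPlus1 : ℕ → ℕ → Set
LtSqrt2TimesPlus1 a n = a ≡ 0 ⊎ (a ∸ 1) * (a ∸ 1) < 2 * (n * n)

module Submission where

-- Let S be an independent set of r columns of A^c_G.  Since S
-- itself is not dependent, some row i of the sum of the columns in S is 1,
-- i.e. exactly one column j ∈ S has a 1 in row i: i is not adjacent to j,
-- but adjacent to every other vertex of S.  Removing j and repeating gives a
-- triangular sequence (i₁,j₁) … (i_r,j_r): iₖ is not adjacent to jₖ but
-- adjacent to every later jₗ.  Each such sequence yields r² − r distinct
-- ordered pairs (iₖ,jₗ), (jₗ,iₖ), k < l, all of them edges of G.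
-- Doing the same for the complement, the two families of ordered edges and
-- the n diagonal pairs are pairwise disjoint subsets of V × V, hence
--   (r² − r) + (r̄² − r̄) + n ≤ n²,
-- and with (r + r̄)² ≤ 2(r² + r̄²) this gives (r + r̄ − 1)² < 2n².

open import Defs
open import Data.Bool using (true; false; if_then_else_)
open import Data.Nat using (ℕ; zero; suc; _+_; _*_; _∸_; _≤_; _<_; z≤n; s≤s)
open import Data.Nat.Properties
  using (≤-total; ≤-trans; m≤m+n; +-suc; +-comm; +-cancelˡ-≤; +-monoˡ-≤; *-monoʳ-≤;
         n≤0⇒n≡0; m≤n⇒∃[o]m+o≡n; suc-injective; module ≤-Reasoning)
open import Data.Nat.Tactic.RingSolver using (solve-∀)
open import Data.Fin using (Fin; zero; suc; _≟_)
open import Data.Fin.Properties using (¬∀⟶∃¬)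
open import Data.Fin.Subset using (Subset; _⊆_; Nonempty; ∣_∣; _∈_; _─_; _-_; ⁅_⁆; inside; outside)
open import Data.Fin.Subset.Properties
  using (∣p∣≤n; ∣⊥∣≡0; p─⊥≡p; p─q⊆p; x∉⁅y⁆⇒x≢y; nonempty?; Empty-unique)
open import Data.Vec using (_∷_; lookup; here; there)
open import Data.Vec.Properties using ([]=⇒lookup; lookup⇒[]=)
open import Data.List using (List; []; _∷_; _++_; length; map; allFin; cartesianProduct)
open import Data.List.Properties using (length-++; length-map; length-tabulate)
open import Data.List.Relation.Unary.All as All using (All; []; _∷_)
import Data.List.Relation.Unary.All.Properties as AllP
import Data.List.Relation.Unary.Any as Any
open import Data.List.Relation.Unary.Unique.Propositional using (Unique; []; _∷_)
import Data.List.Relation.Unary.Unique.Propositional.Properties as Unique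
open import Data.List.Relation.Binary.Disjoint.Propositional using (Disjoint)
open import Data.List.Membership.Propositional using () renaming (_∈_ to _∈ₗ_)
open import Data.List.Membership.Propositional.Properties
  using (∈-∃++; ∈-++⁺ˡ; ∈-++⁺ʳ; ∈-++⁻; ∈-allFin; ∈-cartesianProduct⁺)
open import Data.Product using (Σ; _×_; _,_; proj₁; proj₂)
open import Data.Sum using (_⊎_; inj₁; inj₂)
open import Data.Empty using (⊥; ⊥-elim)
open import Function using (_∘_)
open import Relation.Nullary using (¬_; Dec; yes; no)
open import Relation.Binary.PropositionalEquality

ghost? : (x : SB) → Dec (IsGhost x)
ghost? 𝟘  = yes (inj₁ refl)
ghost? 𝟙  = no λ { (inj₁ ()) ; (inj₂ ()) }
ghost? 𝟙ν = yes (inj₂ refl)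

non-ghost⇒𝟙 : ∀ x → ¬ IsGhost x → x ≡ 𝟙
non-ghost⇒𝟙 𝟘  ¬g = ⊥-elim (¬g (inj₁ refl))
non-ghost⇒𝟙 𝟙  ¬g = refl
non-ghost⇒𝟙 𝟙ν ¬g = ⊥-elim (¬g (inj₂ refl))

⊕≡𝟘 : ∀ x y → x ⊕ y ≡ 𝟘 → x ≡ 𝟘 × y ≡ 𝟘
⊕≡𝟘 𝟘 y eq = refl , eq
⊕≡𝟘 𝟙 𝟘  ()
⊕≡𝟘 𝟙 𝟙  ()
⊕≡𝟘 𝟙 𝟙ν ()
⊕≡𝟘 𝟙ν y ()

⊕≡𝟙 : ∀ x y → x ⊕ y ≡ 𝟙 → (x ≡ 𝟘 × y ≡ 𝟙) ⊎ (x ≡ 𝟙 × y ≡ 𝟘)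
⊕≡𝟙 𝟘 y eq = inj₁ (refl , eq)
⊕≡𝟙 𝟙 𝟘  eq = inj₂ (refl , refl)
⊕≡𝟙 𝟙 𝟙  ()
⊕≡𝟙 𝟙 𝟙ν ()
⊕≡𝟙 𝟙ν y ()

sum≡𝟘 : ∀ {m} (f : Fin m → SB) → sumSB f ≡ 𝟘 → ∀ k → f k ≡ 𝟘
sum≡𝟘 f eq zero    = proj₁ (⊕≡𝟘 _ _ eq)
sum≡𝟘 f eq (suc k) = sum≡𝟘 (λ j → f (suc j)) (proj₂ (⊕≡𝟘 _ _ eq)) k

sum≡𝟙 : ∀ {m} (f : Fin m → SB) → sumSB f ≡ 𝟙 →
        Σ (Fin m) λ j → f j ≡ 𝟙 × (∀ k → k ≢ j → f k ≡ 𝟘)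
sum≡𝟙 {zero} f ()
sum≡𝟙 {suc m} f eq with ⊕≡𝟙 _ _ eq
... | inj₂ (f₀≡𝟙 , rest≡𝟘) =
  zero , f₀≡𝟙 , λ { zero 0≢0 → ⊥-elim (0≢0 refl) ; (suc k) _ → sum≡𝟘 _ rest≡𝟘 k }
... | inj₁ (f₀≡𝟘 , rest≡𝟙) with sum≡𝟙 (λ j → f (suc j)) rest≡𝟙
...   | j , fj≡𝟙 , others =
  suc j , fj≡𝟙 , λ { zero _ → f₀≡𝟘 ; (suc k) k≢j → others k (λ eq → k≢j (cong suc eq)) }

term≡𝟙 : ∀ b c → fromBool b ⊗ (if c then 𝟘 else 𝟙) ≡ 𝟙 → b ≡ true × c ≡ false
term≡𝟙 true  false _ = refl , refl
term≡𝟙 true  true  ()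
term≡𝟙 false c    ()

term≡𝟘 : ∀ b c → fromBool b ⊗ (if c then 𝟘 else 𝟙) ≡ 𝟘 → b ≡ true → c ≡ true
term≡𝟘 true true  _  _ = refl
term≡𝟘 true false () _

module _ {n} (H : Graph n) where

  adjacent⇒≢ : ∀ {a b} → adj H a b ≡ true → a ≢ b
  adjacent⇒≢ {a} adj≡true refl with trans (sym adj≡true) (adj-irrefl H a)
  ... | ()

  separates : ∀ {a b c} → adj H a b ≡ true → adj H a c ≡ false → b ≢ c
  separates adj≡true adj≡false refl with trans (sym adj≡true) adj≡false
  ... | ()

complement-adj : ∀ {n} (G : Graph n) {a b} → adj G a b ≡ true → adj (complement G) a b ≡ false
complement-adj G {a} {b} adj≡true with a ≟ b
... | yes _ = refl
... | no _ rewrite adj≡true = refl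

size≡suc⇒nonempty : ∀ {m k} (p : Subset m) → ∣ p ∣ ≡ suc k → Nonempty p
size≡suc⇒nonempty {m} p ∣p∣≡1+k with nonempty? p
... | yes ne = ne
... | no ¬ne with () ← trans (sym ∣p∣≡1+k) (trans (cong ∣_∣ (Empty-unique ¬ne)) (∣⊥∣≡0 m))

x∈p─q⇒x∉q : ∀ {m} {x : Fin m} (p q : Subset m) → x ∈ p ─ q → ¬ (x ∈ q)
x∈p─q⇒x∉q (inside  ∷ p) (outside ∷ q) here        ()
x∈p─q⇒x∉q (_       ∷ p) (_       ∷ q) (there x∈) (there x∈q) = x∈p─q⇒x∉q p q x∈ x∈q

x∈p-y⇒x≢y : ∀ {m} {x y : Fin m} (p : Subset m) → x ∈ p - y → x ≢ y
x∈p-y⇒x≢y {y = y} p x∈ = x∉⁅y⁆⇒x≢y (x∈p─q⇒x∉q p ⁅ y ⁆ x∈)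

∣p-x∣ : ∀ {m} {x : Fin m} {p : Subset m} → x ∈ p → suc ∣ p - x ∣ ≡ ∣ p ∣
∣p-x∣ {p = inside  ∷ p} here       = cong (suc ∘ ∣_∣) (p─⊥≡p p)
∣p-x∣ {p = inside  ∷ p} (there x∈) = cong suc (∣p-x∣ x∈)
∣p-x∣ {p = outside ∷ p} (there x∈) = ∣p-x∣ x∈

-- Dependence is witnessed by subsets, so independence passes to subsets.
independent-⊆ : ∀ {n} {A : Fin n → Fin n → SB} {S T : Subset n} →
                T ⊆ S → IndependentCols A S → IndependentCols A T
independent-⊆ T⊆S indS (U , U⊆T , ne , ghost) = indS (U , (λ x∈U → T⊆S (U⊆T x∈U)) , ne , ghost)

targets : ∀ {n} → List (Fin n × Fin n) → List (Fin n)
targets = map proj₂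

data Triangular {n} (H : Graph n) : List (Fin n × Fin n) → Set where
  []   : Triangular H []
  cons : ∀ {i j L} → adj H i j ≡ false → All (λ j′ → adj H i j′ ≡ true) (targets L) →
         Triangular H L → Triangular H ((i , j) ∷ L)

module _ {n} (H : Graph n) where

  -- A nonempty independent set S of columns of A^c_H has a pivot: a row i and
  -- a column j ∈ S such that j is the only vertex of S not adjacent to i.
  -- (The sum of all columns of S is not ghost, so some row sums to 1.)
  pivot : ∀ {S} → IndependentCols (cAdjMatrix H) S → Nonempty S →
          Σ (Fin n) λ i → Σ (Fin n) λ j → j ∈ S × adj H i j ≡ false ×
            (∀ {j′} → j′ ∈ S → j′ ≢ j → adj H i j′ ≡ true)
  pivot {S} indS neS = i , j , j∈S , ¬adj-ij , adj-others
    where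
    notAllGhost : ¬ (∀ i → IsGhost (combo (cAdjMatrix H) S i))
    notAllGhost allGhost = indS (S , (λ x∈ → x∈) , neS , allGhost)
    row : Σ (Fin n) λ i → ¬ IsGhost (combo (cAdjMatrix H) S i)
    row = ¬∀⟶∃¬ n _ (λ i → ghost? (combo (cAdjMatrix H) S i)) notAllGhost
    i : Fin n
    i = proj₁ row
    term : Fin n → SB
    term j = fromBool (lookup S j) ⊗ cAdjMatrix H i j
    column : Σ (Fin n) λ j → term j ≡ 𝟙 × (∀ k → k ≢ j → term k ≡ 𝟘)
    column = sum≡𝟙 term (non-ghost⇒𝟙 _ (proj₂ row))
    j : Fin n
    j = proj₁ column
    term-j : lookup S j ≡ true × adj H i j ≡ false
    term-j = term≡𝟙 (lookup S j) (adj H i j) (proj₁ (proj₂ column))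
    j∈S : j ∈ S
    j∈S = lookup⇒[]= j S (proj₁ term-j)
    ¬adj-ij : adj H i j ≡ false
    ¬adj-ij = proj₂ term-j
    adj-others : ∀ {j′} → j′ ∈ S → j′ ≢ j → adj H i j′ ≡ true
    adj-others {j′} j′∈S j′≢j =
      term≡𝟘 (lookup S j′) (adj H i j′) (proj₂ (proj₂ column) j′ j′≢j) ([]=⇒lookup j′∈S)

  -- Repeatedly extracting pivots turns an independent set of k columns into
  -- a triangular sequence of length k whose targets lie in S.
  triangular : ∀ k (S : Subset n) → ∣ S ∣ ≡ k → IndependentCols (cAdjMatrix H) S →
               Σ (List (Fin n × Fin n)) λ L →
                 length L ≡ k × Triangular H L × All (_∈ S) (targets L)
  triangular zero    S _ _ = [] , refl , [] , []
  triangular (suc k) S ∣S∣≡1+k indS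
    with i , j , j∈S , ¬adj-ij , adj-others ← pivot indS (size≡suc⇒nonempty S ∣S∣≡1+k)
    with L , ∣L∣≡k , triL , L⊆S-j ←
           triangular k (S - j) (suc-injective (trans (∣p-x∣ j∈S) ∣S∣≡1+k))
                      (independent-⊆ (p─q⊆p S ⁅ j ⁆) indS)
    = (i , j) ∷ L , cong suc ∣L∣≡k
    , cons ¬adj-ij (All.map (λ j′∈ → adj-others (p─q⊆p S ⁅ j ⁆ j′∈) (x∈p-y⇒x≢y S j′∈)) L⊆S-j) triL
    , j∈S ∷ All.map (p─q⊆p S ⁅ j ⁆) L⊆S-j

edgePairs : ∀ {n} → List (Fin n × Fin n) → List (Fin n × Fin n)
edgePairs []            = []
edgePairs ((i , _) ∷ L) = map (i ,_) (targets L) ++ map (_, i) (targets L) ++ edgePairs L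

edgePairs-length : ∀ {n} (L : List (Fin n × Fin n)) →
                   length (edgePairs L) + length L ≡ length L * length L
edgePairs-length []            = refl
edgePairs-length ((i , _) ∷ L) = begin
  length (map (i ,_) ts ++ map (_, i) ts ++ edgePairs L) + suc m
    ≡⟨ cong (_+ suc m) (length-++ (map (i ,_) ts)) ⟩
  length (map (i ,_) ts) + length (map (_, i) ts ++ edgePairs L) + suc m
    ≡⟨ cong (λ l → length (map (i ,_) ts) + l + suc m) (length-++ (map (_, i) ts)) ⟩
  length (map (i ,_) ts) + (length (map (_, i) ts) + length (edgePairs L)) + suc m
    ≡⟨ cong₂ (λ a b → a + (b + length (edgePairs L)) + suc m)
             (trans (length-map _ ts) (length-map _ L)) (trans (length-map _ ts) (length-map _ L)) ⟩
  m + (m + length (edgePairs L)) + suc m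
    ≡⟨ regroup m (length (edgePairs L)) ⟩
  suc (m + m) + (length (edgePairs L) + m)
    ≡⟨ cong (suc (m + m) +_) (edgePairs-length L) ⟩
  suc (m + m) + m * m
    ≡⟨ square-suc m ⟩
  suc m * suc m ∎
  where
  open ≡-Reasoning
  ts : List (Fin _)
  ts = targets L
  m : ℕ
  m = length L
  regroup : ∀ m p → m + (m + p) + suc m ≡ suc (m + m) + (p + m)
  regroup = solve-∀
  square-suc : ∀ m → suc (m + m) + m * m ≡ suc m * suc m
  square-suc = solve-∀

disjoint-by : ∀ {A : Set} {P Q : A → Set} {xs ys : List A} →
              All P xs → All Q ys → (∀ {x} → P x → Q x → ⊥) → Disjoint xs ys
disjoint-by Pxs Qys incompatible (x∈xs , x∈ys) = incompatible (All.lookup Pxs x∈xs) (All.lookup Qys x∈ys)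

module _ {n} (H : Graph n) where

  Adjacent : Fin n × Fin n → Set
  Adjacent p = adj H (proj₁ p) (proj₂ p) ≡ true

  Avoids : Fin n → Fin n × Fin n → Set
  Avoids v p = proj₁ p ≢ v × proj₂ p ≢ v

  edgePairs-adjacent : ∀ {L} → Triangular H L → All Adjacent (edgePairs L)
  edgePairs-adjacent []                              = []
  edgePairs-adjacent {(i , _) ∷ L} (cons _ adjs triL) =
    AllP.++⁺ (AllP.map⁺ adjs)
      (AllP.++⁺ (AllP.map⁺ (All.map (λ {j′} adj≡ → trans (adj-sym H j′ i) adj≡) adjs))
                (edgePairs-adjacent triL))

  edgePairs-avoid : ∀ {v L} → All (Avoids v) L → All (Avoids v) (edgePairs L)
  edgePairs-avoid []                                    = []
  edgePairs-avoid {v} {(i , _) ∷ L} ((i≢v , _) ∷ avoids) =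
    AllP.++⁺ (AllP.map⁺ (All.map (i≢v ,_) targets-avoid))
      (AllP.++⁺ (AllP.map⁺ (All.map (_, i≢v) targets-avoid)) (edgePairs-avoid avoids))
    where
    targets-avoid : All (_≢ v) (targets L)
    targets-avoid = AllP.map⁺ (All.map proj₂ avoids)

  pivot-avoids : ∀ {i L} → All (λ j′ → adj H i j′ ≡ true) (targets L) → Triangular H L → All (Avoids i) L
  pivot-avoids []               []                 = []
  pivot-avoids (adj-ij′ ∷ adjs) (cons ¬adj _ triL) =
    ((λ { refl → separates H adj-ij′ ¬adj refl }) , (λ j′≡i → adjacent⇒≢ H adj-ij′ (sym j′≡i)))
    ∷ pivot-avoids adjs triL

  targets-unique : ∀ {L} → Triangular H L → Unique (targets L)
  targets-unique []                    = []
  targets-unique (cons ¬adj adjs triL) =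
    All.map (λ adj-ij′ j≡j′ → separates H adj-ij′ ¬adj (sym j≡j′)) adjs ∷ targets-unique triL

  -- The edge pairs of a triangular sequence are distinct: pairs through the
  -- first pivot i have the shape (i, j′) or (j′, i) with j′ ≢ i, and all later
  -- pairs avoid i.
  edgePairs-unique : ∀ {L} → Triangular H L → Unique (edgePairs L)
  edgePairs-unique []                               = []
  edgePairs-unique {(i , _) ∷ L} (cons _ adjs triL) =
    Unique.++⁺ (Unique.map⁺ (cong proj₂) ts-unique)
      (Unique.++⁺ (Unique.map⁺ (cong proj₁) ts-unique) (edgePairs-unique triL)
        (disjoint-by into-i later-avoid λ b≡i (_ , b≢i) → b≢i b≡i))
      (disjoint-by out-of-i (AllP.++⁺ (All.map inj₁ into-i) (All.map inj₂ later-avoid))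
        λ { (_ , b≢i) (inj₁ b≡i) → b≢i b≡i ; (a≡i , _) (inj₂ (a≢i , _)) → a≢i a≡i })
    where
    ts : List (Fin n)
    ts = targets L
    ts-unique : Unique ts
    ts-unique = targets-unique triL
    out-of-i : All (λ p → proj₁ p ≡ i × proj₂ p ≢ i) (map (i ,_) ts)
    out-of-i = AllP.map⁺ (All.map (λ adj-ij′ → refl , λ j′≡i → adjacent⇒≢ H adj-ij′ (sym j′≡i)) adjs)
    into-i : All (λ p → proj₂ p ≡ i) (map (_, i) ts)
    into-i = AllP.map⁺ (All.universal (λ _ → refl) ts)
    later-avoid : All (Avoids i) (edgePairs L)
    later-avoid = edgePairs-avoid (pivot-avoids adjs triL)

unique⇒length≤ : ∀ {A : Set} {xs ys : List A} → Unique xs → (∀ {x} → x ∈ₗ xs → x ∈ₗ ys) →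
                 length xs ≤ length ys
unique⇒length≤ {xs = []}     _              _     = z≤n
unique⇒length≤ {xs = x ∷ xs} (x∉xs ∷ xs-unique) xs⊆ys
  with as , bs , refl ← ∈-∃++ (xs⊆ys (Any.here refl)) = begin
    suc (length xs)             ≤⟨ s≤s (unique⇒length≤ xs-unique xs⊆as++bs) ⟩
    suc (length (as ++ bs))     ≡⟨ cong suc (length-++ as) ⟩
    suc (length as + length bs) ≡⟨ +-suc (length as) (length bs) ⟨
    length as + suc (length bs) ≡⟨ length-++ as ⟨
    length (as ++ x ∷ bs)       ∎
  where
  open ≤-Reasoning
  -- Removing x from ys keeps the other elements of xs, since x ∉ xs.
  xs⊆as++bs : ∀ {y} → y ∈ₗ xs → y ∈ₗ as ++ bs
  xs⊆as++bs {y} y∈xs with ∈-++⁻ as (xs⊆ys (Any.there y∈xs))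
  ... | inj₁ y∈as              = ∈-++⁺ˡ y∈as
  ... | inj₂ (Any.here refl)   = ⊥-elim (All.lookup x∉xs y∈xs refl)
  ... | inj₂ (Any.there y∈bs)  = ∈-++⁺ʳ as y∈bs

length-cartesianProduct : ∀ {A B : Set} (xs : List A) (ys : List B) →
                          length (cartesianProduct xs ys) ≡ length xs * length ys
length-cartesianProduct []       ys = refl
length-cartesianProduct (x ∷ xs) ys =
  trans (length-++ (map (x ,_) ys)) (cong₂ _+_ (length-map _ ys) (length-cartesianProduct xs ys))

length-allFin : ∀ n → length (allFin n) ≡ n
length-allFin n = length-tabulate {n = n} (λ v → v)

unique-pairs≤ : ∀ {n} {ps : List (Fin n × Fin n)} → Unique ps → length ps ≤ n * n
unique-pairs≤ {n} {ps} ps-unique = begin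
  length ps                                           ≤⟨ unique⇒length≤ ps-unique everyPair ⟩
  length (cartesianProduct (allFin n) (allFin n))     ≡⟨ length-cartesianProduct (allFin n) (allFin n) ⟩
  length (allFin n) * length (allFin n)               ≡⟨ cong (λ l → l * l) (length-allFin n) ⟩
  n * n                                               ∎
  where
  open ≤-Reasoning
  everyPair : ∀ {p} → p ∈ₗ ps → p ∈ₗ cartesianProduct (allFin n) (allFin n)
  everyPair {a , b} _ = ∈-cartesianProduct⁺ (∈-allFin a) (∈-allFin b)

diagonal : ∀ n → List (Fin n × Fin n)
diagonal n = map (λ v → v , v) (allFin n)

-- The ordered edge pairs of a triangular sequence of G, those of one of its
-- complement, and the diagonal are pairwise disjoint, hence
-- (r² − r) + (s² − s) + n ≤ n², written without subtraction.
complementary-bound : ∀ {n} (G : Graph n) {L M} → Triangular G L → Triangular (complement G) M →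
  length L * length L + length M * length M + n ≤ n * n + (length L + length M)
complementary-bound {n} G {L} {M} triL triM = begin
  r * r + s * s + n
    ≡⟨ cong₂ (λ a b → a + b + n) (edgePairs-length L) (edgePairs-length M) ⟨
  length PL + r + (length PM + s) + n
    ≡⟨ regroup (length PL) (length PM) r s n ⟩
  length PL + (length PM + n) + (r + s)
    ≡⟨ cong (λ l → length PL + (length PM + l) + (r + s)) (trans (length-map _ (allFin n)) (length-allFin n)) ⟨
  length PL + (length PM + length (diagonal n)) + (r + s)
    ≡⟨ cong (_+ (r + s)) (trans (length-++ PL) (cong (length PL +_) (length-++ PM))) ⟨
  length (PL ++ PM ++ diagonal n) + (r + s)
    ≤⟨ +-monoˡ-≤ (r + s) (unique-pairs≤ all-unique) ⟩
  n * n + (r + s) ∎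
  where
  open ≤-Reasoning
  Ḡ : Graph n
  Ḡ = complement G
  r s : ℕ
  r = length L
  s = length M
  PL PM : List (Fin n × Fin n)
  PL = edgePairs L
  PM = edgePairs M
  regroup : ∀ p q r s n → p + r + (q + s) + n ≡ p + (q + n) + (r + s)
  regroup = solve-∀
  on-diagonal : All (λ p → proj₁ p ≡ proj₂ p) (diagonal n)
  on-diagonal = AllP.map⁺ (All.universal (λ _ → refl) (allFin n))
  all-unique : Unique (PL ++ PM ++ diagonal n)
  all-unique =
    Unique.++⁺ (edgePairs-unique G triL)
      (Unique.++⁺ (edgePairs-unique Ḡ triM) (Unique.map⁺ (cong proj₁) (Unique.allFin⁺ n))
        (disjoint-by (edgePairs-adjacent Ḡ triM) on-diagonal (adjacent⇒≢ Ḡ)))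
      (disjoint-by (edgePairs-adjacent G triL)
        (AllP.++⁺ (All.map inj₁ (edgePairs-adjacent Ḡ triM)) (All.map inj₂ on-diagonal))
        λ { adjG (inj₁ adjḠ) → true≢false (trans (sym adjḠ) (complement-adj G adjG))
          ; adjG (inj₂ a≡b)  → adjacent⇒≢ G adjG a≡b })
    where
    true≢false : true ≢ false
    true≢false ()

-- The quadratic-mean inequality (r + s)² ≤ 2(r² + s²), first for r ≤ s:
-- writing s = r + d, the gap is exactly d².
square-of-sum≤-ordered : ∀ r s → r ≤ s → (r + s) * (r + s) ≤ 2 * (r * r + s * s)
square-of-sum≤-ordered r s r≤s with d , refl ← m≤n⇒∃[o]m+o≡n r≤s =
  subst ((r + (r + d)) * (r + (r + d)) ≤_) (gap r d) (m≤m+n _ (d * d))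
  where
  gap : ∀ r d → (r + (r + d)) * (r + (r + d)) + d * d ≡ 2 * (r * r + (r + d) * (r + d))
  gap = solve-∀

square-of-sum≤ : ∀ r s → (r + s) * (r + s) ≤ 2 * (r * r + s * s)
square-of-sum≤ r s with ≤-total r s
... | inj₁ r≤s = square-of-sum≤-ordered r s r≤s
... | inj₂ s≤r = subst₂ _≤_ (cong (λ a → a * a) (+-comm s r)) (cong (2 *_) (+-comm (s * s) (r * r)))
                   (square-of-sum≤-ordered s r s≤r)

-- For n = 1 + m ≥ 1: if a² + 2n ≤ 2n² + 2a then (a − 1)² < 2n²; for a = b + 1
-- the hypothesis cancels to b² + 2m + 1 ≤ 2n².
shifted-square< : ∀ m a → a * a + 2 * suc m ≤ 2 * (suc m * suc m) + 2 * a →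
                  (a ∸ 1) * (a ∸ 1) < 2 * (suc m * suc m)
shifted-square< m zero    _ = s≤s z≤n
shifted-square< m (suc b) h =
  ≤-trans (s≤s (m≤m+n (b * b) (2 * m)))
          (+-cancelˡ-≤ (2 * b + 2) _ _ (subst₂ _≤_ (lhs b m) (rhs b m) h))
  where
  lhs : ∀ b m → suc b * suc b + 2 * suc m ≡ (2 * b + 2) + suc (b * b + 2 * m)
  lhs = solve-∀
  rhs : ∀ b m → 2 * (suc m * suc m) + 2 * suc b ≡ (2 * b + 2) + 2 * (suc m * suc m)
  rhs = solve-∀

sqrt2-bound : ∀ n r s → r ≤ n → s ≤ n → r * r + s * s + n ≤ n * n + (r + s) →
              LtSqrt2TimesPlus1 (r + s) n
sqrt2-bound zero    r s r≤0 s≤0 _ = inj₁ (cong₂ _+_ (n≤0⇒n≡0 r≤0) (n≤0⇒n≡0 s≤0))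
sqrt2-bound (suc m) r s _   _   h = inj₂ (shifted-square< m (r + s) (begin
  (r + s) * (r + s) + 2 * n          ≤⟨ +-monoˡ-≤ (2 * n) (square-of-sum≤ r s) ⟩
  2 * (r * r + s * s) + 2 * n        ≡⟨ distrib (r * r + s * s) n ⟨
  2 * (r * r + s * s + n)            ≤⟨ *-monoʳ-≤ 2 h ⟩
  2 * (n * n + (r + s))              ≡⟨ distrib (n * n) (r + s) ⟩
  2 * (n * n) + 2 * (r + s)          ∎))
  where
  open ≤-Reasoning
  n : ℕ
  n = suc m
  distrib : ∀ x y → 2 * (x + y) ≡ 2 * x + 2 * y
  distrib = solve-∀

proposition9p2 : ∀ (n : ℕ) (G : Graph n) (r r̄ : ℕ) →
    IsCRank G r → IsCRank (complement G) r̄ →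
    LtSqrt2TimesPlus1 (r + r̄) n
proposition9p2 n G r r̄ ((S , indS , ∣S∣≡r) , _) ((S̄ , indS̄ , ∣S̄∣≡r̄) , _)
  with L , refl , triL , _ ← triangular G r S ∣S∣≡r indS
     | M , refl , triM , _ ← triangular (complement G) r̄ S̄ ∣S̄∣≡r̄ indS̄
  = sqrt2-bound n (length L) (length M)
      (subst (_≤ n) ∣S∣≡r (∣p∣≤n S)) (subst (_≤ n) ∣S̄∣≡r̄ (∣p∣≤n S̄))
      (complementary-bound G triL triM)
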